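{- For every integer $n>5$, if $2^{2^{n-5}}+1$ is prime, then \[ \theta(n) \geqslant \left(2^{2^{n-5}}-1\right)^{2^{n-5}}+1. \] In particular, $\theta(9) \geqslant \left(2^{16}-1\right)^{16}+1 > 2^{240} > 2^{2^{7}}$.
   Context: For a positive integer $n$, let $E_n=\{x_i \cdot x_j=x_k,\ x_i+1=x_k:\ i,j,k \in \{1,\ldots,n\}\}$, a set of equations in the variables $x_1,\ldots,x_n$. Let $\theta(n)$ denote the smallest positive integer $b$ such that for each system $S \subseteq E_n$ which has a solution in positive integers $x_1,\ldots,x_n$ and which has only finitely many solutions in positive integers $x_1,\ldots,x_n$, there exists a solution of $S$ in $([1,b] \cap \mathbb{N})^n$. -}

module Defs where

open import Data.Nat using (ℕ; _+_; _*_; _≤_)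
open import Data.Fin using (Fin)
open import Data.Vec using (Vec; lookup)
open import Data.List using (List)
open import Data.List.Relation.Unary.All using (All)
open import Data.List.Membership.Propositional using (_∈_)
open import Data.Product using (Σ; ∃; _×_)
open import Relation.Binary.PropositionalEquality using (_≡_)

data Eqn (n : ℕ) : Set where
  mul  : Fin n → Fin n → Fin n → Eqn n
  suc1 : Fin n → Fin n → Eqn n

System : ℕ → Set
System n = List (Eqn n)

Holds : ∀ {n} → Vec ℕ n → Eqn n → Set
Holds x (mul i j k) = lookup x i * lookup x j ≡ lookup x k
Holds x (suc1 i k)  = lookup x i + 1 ≡ lookup x k

IsSolution : ∀ {n} → System n → Vec ℕ n → Set
IsSolution {n} S x = (∀ (i : Fin n) → 1 ≤ lookup x i) × All (Holds x) S

FinitelyManySolutions : ∀ {n} → System n → Set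
FinitelyManySolutions {n} S =
  Σ (List (Vec ℕ n)) λ L → ∀ (x : Vec ℕ n) → IsSolution S x → x ∈ L

-- b has the property in the definition of θ(n): every solvable system
-- S ⊆ E_n with finitely many solutions has a solution in [1,b]^n.
Bounds : ℕ → ℕ → Set
Bounds n b = ∀ (S : System n) →
  (∃ λ x → IsSolution S x) →
  FinitelyManySolutions S →
  ∃ λ x → IsSolution S x × (∀ (i : Fin n) → lookup x i ≤ b)

-- "θ(n) ≥ m": since θ(n) is the least positive b with `Bounds n b`,
-- θ(n) ≥ m means every positive b with `Bounds n b` is ≥ m.
ThetaAtLeast : ℕ → ℕ → Set
ThetaAtLeast n m = ∀ (b : ℕ) → 1 ≤ b → Bounds n b → m ≤ b

{-# OPTIONS --safe #-}
module Submission where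

-- Let k ≥ 1 and F = 2 ^ 2 ^ k + 1 be prime. Using x_{i+1} = x_i · x_i and the
-- successor equations, a system in k + 5 unknowns expresses that x₀ + 2
-- divides x₀ ^ 2 ^ k + 1. As x₀ ≡ -2 modulo x₀ + 2 and 2 ^ k is even, this
-- forces x₀ + 2 ∣ F, hence x₀ + 2 = F. So the system has exactly one solution,
-- and that solution contains x_k + 1 = (F - 2) ^ 2 ^ k + 1, which therefore
-- bounds every admissible b from below.

open import Defs
open import Data.Nat using (ℕ; zero; suc; _+_; _*_; _∸_; _^_; _%_; _<_; _≤_; z≤n; s≤s; NonZero)
open import Data.Nat.Properties
open import Data.Nat.DivMod using ([m+kn]%n≡m%n; %-distribˡ-+; %-distribˡ-*)
open import Data.Nat.Divisibility using (_∣_; divides; ∣-reflexive; m%n≡0⇒n∣m; n∣m⇒m%n≡0)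
open import Data.Nat.Primality using (Prime; prime?; prime⇒irreducible)
open import Data.Nat.Tactic.RingSolver using (solve-∀)
open import Data.Fin using (Fin; zero; suc; fromℕ; toℕ; _↑ʳ_)
open import Data.Fin.Properties using (toℕ-fromℕ)
open import Data.Vec using (Vec; []; _∷_; _++_; lookup)
open import Data.Vec.Properties using (lookup-++ʳ)
open import Data.List using ([]; _∷_; map)
open import Data.List.Relation.Unary.All as All using (All; []; _∷_)
open import Data.List.Relation.Unary.All.Properties using (map⁺; map⁻)
open import Data.List.Relation.Unary.Any using (here)
open import Data.Product using (∃₂; _×_; _,_)
open import Data.Sum using (inj₁; inj₂)
open import Function using (id)
open import Relation.Nullary using (contradiction)
open import Relation.Binary.PropositionalEquality
open import Relation.Nullary.Decidable using (from-yes)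
open ≡-Reasoning

unique-solution⇒ThetaAtLeast : ∀ {n} (S : System n) (v : Vec ℕ n) →
  IsSolution S v → (∀ x → IsSolution S x → x ≡ v) →
  ∀ i → ThetaAtLeast n (lookup v i)
unique-solution⇒ThetaAtLeast S v v-sol unique i b _ bounds
  with bounds S (v , v-sol) (v ∷ [] , λ x x-sol → here (unique x x-sol))
... | x , x-sol , x≤b = subst (λ y → lookup y i ≤ b) (unique x x-sol) (x≤b i)

[m*m]^n≡m^[2*n] : ∀ m n → (m * m) ^ n ≡ m ^ (2 * n)
[m*m]^n≡m^[2*n] m n = begin
  (m * m) ^ n       ≡⟨ cong (λ y → (m * y) ^ n) (*-identityʳ m) ⟨
  (m ^ 2) ^ n       ≡⟨ ^-*-assoc m 2 n ⟩
  m ^ (2 * n)       ∎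

m*n≡o+1⇒1≤m : ∀ m {n o} → m * n ≡ o + 1 → 1 ≤ m
m*n≡o+1⇒1≤m zero    {o = o} 0≡o+1 = contradiction (sym 0≡o+1) (m+1+n≢0 o)
m*n≡o+1⇒1≤m (suc _) _             = s≤s z≤n

m+1+1≡2+m : ∀ m → m + 1 + 1 ≡ 2 + m
m+1+1≡2+m m = trans (+-assoc m 1 1) (+-comm m 2)

rename : ∀ {m n} → (Fin m → Fin n) → Eqn m → Eqn n
rename ρ (mul i j k) = mul (ρ i) (ρ j) (ρ k)
rename ρ (suc1 i k)  = suc1 (ρ i) (ρ k)

Holds-++-↑ʳ : ∀ {m n} (p : Vec ℕ m) (x : Vec ℕ n) e →
  Holds (p ++ x) (rename (m ↑ʳ_) e) ≡ Holds x e
Holds-++-↑ʳ p x (mul i j k)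
  rewrite lookup-++ʳ p x i | lookup-++ʳ p x j | lookup-++ʳ p x k = refl
Holds-++-↑ʳ p x (suc1 i k)
  rewrite lookup-++ʳ p x i | lookup-++ʳ p x k = refl

All-Holds-++-↑ʳ⁻ : ∀ {m n} (p : Vec ℕ m) (x : Vec ℕ n) S →
  All (Holds (p ++ x)) (map (rename (m ↑ʳ_)) S) → All (Holds x) S
All-Holds-++-↑ʳ⁻ p x S hs =
  All.map (λ {e} → subst id (Holds-++-↑ʳ p x e)) (map⁻ hs)

All-Holds-++-↑ʳ⁺ : ∀ {m n} (p : Vec ℕ m) (x : Vec ℕ n) S →
  All (Holds x) S → All (Holds (p ++ x)) (map (rename (m ↑ʳ_)) S)
All-Holds-++-↑ʳ⁺ p x S hs =
  map⁺ (All.map (λ {e} → subst id (sym (Holds-++-↑ʳ p x e))) hs)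

squaringChain : ℕ → (k : ℕ) → Vec ℕ (suc k)
squaringChain t zero    = t ∷ []
squaringChain t (suc k) = t ∷ squaringChain (t * t) k

squaringEqs : (k : ℕ) → System (suc k)
squaringEqs zero    = []
squaringEqs (suc k) = mul zero zero (suc zero) ∷ map (rename (1 ↑ʳ_)) (squaringEqs k)

lookup-squaringChain : ∀ t k i → lookup (squaringChain t k) i ≡ t ^ 2 ^ toℕ i
lookup-squaringChain t zero    zero    = sym (*-identityʳ t)
lookup-squaringChain t (suc k) zero    = sym (*-identityʳ t)
lookup-squaringChain t (suc k) (suc i) =
  trans (lookup-squaringChain (t * t) k i) ([m*m]^n≡m^[2*n] t (2 ^ toℕ i))

lookup-squaringChain-last : ∀ t k → lookup (squaringChain t k) (fromℕ k) ≡ t ^ 2 ^ k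
lookup-squaringChain-last t k =
  trans (lookup-squaringChain t k (fromℕ k)) (cong (λ i → t ^ 2 ^ i) (toℕ-fromℕ k))

lookup-squaringChain-zero : ∀ t k → lookup (squaringChain t k) zero ≡ t
lookup-squaringChain-zero t zero    = refl
lookup-squaringChain-zero t (suc k) = refl

squaringChain-solves : ∀ t k → All (Holds (squaringChain t k)) (squaringEqs k)
squaringChain-solves t zero    = []
squaringChain-solves t (suc k) =
  sym (lookup-squaringChain-zero (t * t) k)
  ∷ All-Holds-++-↑ʳ⁺ (t ∷ []) _ (squaringEqs k) (squaringChain-solves (t * t) k)

squaringChain-unique : ∀ k (x : Vec ℕ (suc k)) →
  All (Holds x) (squaringEqs k) → x ≡ squaringChain (lookup x zero) k
squaringChain-unique zero    (t ∷ [])    []        = refl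
squaringChain-unique (suc k) (t ∷ x) (t*t≡x₀ ∷ hs) = cong (t ∷_) (begin
  x                                  ≡⟨ squaringChain-unique k x (All-Holds-++-↑ʳ⁻ (t ∷ []) x (squaringEqs k) hs) ⟩
  squaringChain (lookup x zero) k    ≡⟨ cong (λ y → squaringChain y k) t*t≡x₀ ⟨
  squaringChain (t * t) k            ∎)

squaringChain-positive : ∀ {t} k i → 1 ≤ t → 1 ≤ lookup (squaringChain t k) i
squaringChain-positive {t@(suc _)} k i _ =
  subst (1 ≤_) (sym (lookup-squaringChain t k i)) (m^n>0 t (2 ^ toℕ i))

^-cong-% : ∀ {a b} d .{{_ : NonZero d}} n → a % d ≡ b % d → a ^ n % d ≡ b ^ n % d
^-cong-%         d zero    _   = refl
^-cong-% {a} {b} d (suc n) a≡b = begin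
  a * a ^ n % d               ≡⟨ %-distribˡ-* a (a ^ n) d ⟩
  (a % d) * (a ^ n % d) % d   ≡⟨ cong₂ (λ x y → x * y % d) a≡b (^-cong-% d n a≡b) ⟩
  (b % d) * (b ^ n % d) % d   ≡⟨ %-distribˡ-* b (b ^ n) d ⟨
  b * b ^ n % d               ∎

+-congʳ-% : ∀ a b d .{{_ : NonZero d}} c → a % d ≡ b % d → (a + c) % d ≡ (b + c) % d
+-congʳ-% a b d c a≡b = begin
  (a + c) % d             ≡⟨ %-distribˡ-+ a c d ⟩
  (a % d + c % d) % d     ≡⟨ cong (λ x → (x + c % d) % d) a≡b ⟩
  (b % d + c % d) % d     ≡⟨ %-distribˡ-+ b c d ⟨
  (b + c) % d             ∎

∣-resp-% : ∀ a b d .{{_ : NonZero d}} → a % d ≡ b % d → d ∣ a → d ∣ b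
∣-resp-% a b d a≡b d∣a = m%n≡0⇒n∣m b d (trans (sym a≡b) (n∣m⇒m%n≡0 a d d∣a))

^2-%-2+ : ∀ t → t ^ 2 % (2 + t) ≡ 2 ^ 2 % (2 + t)
^2-%-2+ t = begin
  t ^ 2 % (2 + t)                         ≡⟨ [m+kn]%n≡m%n (t ^ 2) 4 (2 + t) ⟨
  (t ^ 2 + 4 * (2 + t)) % (2 + t)         ≡⟨ cong (_% (2 + t)) (identity t) ⟩
  (2 ^ 2 + (2 + t) * (2 + t)) % (2 + t)   ≡⟨ [m+kn]%n≡m%n (2 ^ 2) (2 + t) (2 + t) ⟩
  2 ^ 2 % (2 + t)                         ∎
  where
  identity : ∀ s → s * (s * 1) + 4 * (2 + s) ≡ 4 + (2 + s) * (2 + s)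
  identity = solve-∀

^-even-%-2+ : ∀ t n → t ^ (2 * n) % (2 + t) ≡ 2 ^ (2 * n) % (2 + t)
^-even-%-2+ t n = begin
  t ^ (2 * n) % (2 + t)     ≡⟨ cong (_% (2 + t)) (^-*-assoc t 2 n) ⟨
  (t ^ 2) ^ n % (2 + t)     ≡⟨ ^-cong-% (2 + t) n (^2-%-2+ t) ⟩
  (2 ^ 2) ^ n % (2 + t)     ≡⟨ cong (_% (2 + t)) (^-*-assoc 2 2 n) ⟩
  2 ^ (2 * n) % (2 + t)     ∎

2+∣^even+1⇒2+∣2^even+1 : ∀ t n → 2 + t ∣ t ^ (2 * n) + 1 → 2 + t ∣ 2 ^ (2 * n) + 1
2+∣^even+1⇒2+∣2^even+1 t n = ∣-resp-% (t ^ (2 * n) + 1) (2 ^ (2 * n) + 1) (2 + t)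
  (+-congʳ-% (t ^ (2 * n)) (2 ^ (2 * n)) (2 + t) 1 (^-even-%-2+ t n))

2+∣2^even+1⇒2+∣^even+1 : ∀ t n → 2 + t ∣ 2 ^ (2 * n) + 1 → 2 + t ∣ t ^ (2 * n) + 1
2+∣2^even+1⇒2+∣^even+1 t n = ∣-resp-% (2 ^ (2 * n) + 1) (t ^ (2 * n) + 1) (2 + t)
  (+-congʳ-% (2 ^ (2 * n)) (t ^ (2 * n)) (2 + t) 1 (sym (^-even-%-2+ t n)))

2+∣prime⇒≡ : ∀ {t p} → Prime p → 2 + t ∣ p → 2 + t ≡ p
2+∣prime⇒≡ p-prime 2+t∣p with prime⇒irreducible p-prime 2+t∣p
... | inj₁ ()
... | inj₂ 2+t≡p = 2+t≡p

-- Unknowns s r z u x₀ … x_k, in this order, constrained by s = x₀ + 1, r = s + 1, z = x_k + 1,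
-- u r = z and x_{i+1} = x_i², i.e. (x₀ + 2) u = x₀ ^ 2 ^ k + 1.
module DivisibilitySystem (k : ℕ) where

  system : System (4 + suc k)
  system = suc1 (4 ↑ʳ zero) zero
         ∷ suc1 zero (suc zero)
         ∷ suc1 (4 ↑ʳ fromℕ k) (suc (suc zero))
         ∷ mul (suc (suc (suc zero))) (suc zero) (suc (suc zero))
         ∷ map (rename (4 ↑ʳ_)) (squaringEqs k)

  layout : ℕ → Vec ℕ (suc k) → Vec ℕ (4 + suc k)
  layout u x = (x₀ + 1 ∷ x₀ + 1 + 1 ∷ lookup x (fromℕ k) + 1 ∷ u ∷ []) ++ x
    where
    x₀ : ℕ
    x₀ = lookup x zero

  candidate : ℕ → ℕ → Vec ℕ (4 + suc k)
  candidate t u = layout u (squaringChain t k)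

  solution⇒candidate : ∀ v → All (Holds v) system →
    ∃₂ λ t u → v ≡ candidate t u × u * (2 + t) ≡ t ^ 2 ^ k + 1
  solution⇒candidate (_ ∷ _ ∷ _ ∷ u ∷ x) (refl ∷ refl ∷ refl ∷ ur≡z ∷ hs) =
    t , u , cong (layout u) x≡chain , (begin
      u * (2 + t)                                ≡⟨ cong (u *_) (m+1+1≡2+m t) ⟨
      u * (t + 1 + 1)                            ≡⟨ ur≡z ⟩
      lookup x (fromℕ k) + 1                     ≡⟨ cong (λ y → lookup y (fromℕ k) + 1) x≡chain ⟩
      lookup (squaringChain t k) (fromℕ k) + 1   ≡⟨ cong (_+ 1) (lookup-squaringChain-last t k) ⟩
      t ^ 2 ^ k + 1                              ∎)
    where
    t : ℕ
    t = lookup x zero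

    x≡chain : x ≡ squaringChain t k
    x≡chain = squaringChain-unique k x (All-Holds-++-↑ʳ⁻ (_ ∷ _ ∷ _ ∷ u ∷ []) x (squaringEqs k) hs)

  candidate-solution : ∀ {t u} → 1 ≤ t → u * (2 + t) ≡ t ^ 2 ^ k + 1 →
    IsSolution system (candidate t u)
  candidate-solution {t} {u} 1≤t ur≡z = positive , equations
    where
    chain : Vec ℕ (suc k)
    chain = squaringChain t k

    positive : ∀ i → 1 ≤ lookup (candidate t u) i
    positive zero                         = m≤n+m 1 _
    positive (suc zero)                   = m≤n+m 1 _
    positive (suc (suc zero))             = m≤n+m 1 _
    positive (suc (suc (suc zero)))       = m*n≡o+1⇒1≤m u ur≡z
    positive (suc (suc (suc (suc i))))    = squaringChain-positive k i 1≤t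

    ur≡z′ : u * (lookup chain zero + 1 + 1) ≡ lookup chain (fromℕ k) + 1
    ur≡z′ = begin
      u * (lookup chain zero + 1 + 1)   ≡⟨ cong (λ y → u * (y + 1 + 1)) (lookup-squaringChain-zero t k) ⟩
      u * (t + 1 + 1)                   ≡⟨ cong (u *_) (m+1+1≡2+m t) ⟩
      u * (2 + t)                       ≡⟨ ur≡z ⟩
      t ^ 2 ^ k + 1                     ≡⟨ cong (_+ 1) (lookup-squaringChain-last t k) ⟨
      lookup chain (fromℕ k) + 1        ∎

    equations : All (Holds (candidate t u)) system
    equations = refl ∷ refl ∷ refl ∷ ur≡z′
      ∷ All-Holds-++-↑ʳ⁺ (_ ∷ _ ∷ _ ∷ u ∷ []) chain (squaringEqs k) (squaringChain-solves t k)

module FermatBound (j : ℕ) (fermat-prime : Prime (2 ^ 2 ^ suc j + 1)) where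
  open DivisibilitySystem (suc j)

  t₀ : ℕ
  t₀ = 2 ^ 2 ^ suc j ∸ 1

  2≤2^2^k : 2 ≤ 2 ^ 2 ^ suc j
  2≤2^2^k = ^-monoʳ-≤ 2 (m^n>0 2 (suc j))

  1≤t₀ : 1 ≤ t₀
  1≤t₀ = ∸-monoˡ-≤ 1 2≤2^2^k

  2+t₀≡fermat : 2 + t₀ ≡ 2 ^ 2 ^ suc j + 1
  2+t₀≡fermat = begin
    2 + t₀                     ≡⟨ cong suc (m+[n∸m]≡n (≤-trans (s≤s z≤n) 2≤2^2^k)) ⟩
    suc (2 ^ 2 ^ suc j)        ≡⟨ +-comm 1 (2 ^ 2 ^ suc j) ⟩
    2 ^ 2 ^ suc j + 1          ∎

  divisor-unique : ∀ {t} → 2 + t ∣ t ^ 2 ^ suc j + 1 → t ≡ t₀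
  divisor-unique {t} 2+t∣t^2^k+1 = +-cancelˡ-≡ 2 t t₀ (begin
    2 + t              ≡⟨ 2+∣prime⇒≡ fermat-prime (2+∣^even+1⇒2+∣2^even+1 t (2 ^ j) 2+t∣t^2^k+1) ⟩
    2 ^ 2 ^ suc j + 1  ≡⟨ 2+t₀≡fermat ⟨
    2 + t₀             ∎)

  t₀-divisor : 2 + t₀ ∣ t₀ ^ 2 ^ suc j + 1
  t₀-divisor = 2+∣2^even+1⇒2+∣^even+1 t₀ (2 ^ j) (∣-reflexive 2+t₀≡fermat)

  u₀ : ℕ
  u₀ = _∣_.quotient t₀-divisor

  u₀[2+t₀]≡t₀^2^k+1 : u₀ * (2 + t₀) ≡ t₀ ^ 2 ^ suc j + 1
  u₀[2+t₀]≡t₀^2^k+1 = sym (_∣_.equality t₀-divisor)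

  solution : Vec ℕ (5 + suc j)
  solution = candidate t₀ u₀

  solution-unique : ∀ v → IsSolution system v → v ≡ solution
  solution-unique v (_ , equations) with solution⇒candidate v equations
  ... | t , u , refl , ur≡z with divisor-unique (divides u (sym ur≡z))
  ... | refl = cong (candidate t₀) (*-cancelʳ-≡ u u₀ (2 + t₀) (trans ur≡z (sym u₀[2+t₀]≡t₀^2^k+1)))

  theta-bound : ThetaAtLeast (5 + suc j) (t₀ ^ 2 ^ suc j + 1)
  theta-bound = subst (ThetaAtLeast (5 + suc j)) (cong (_+ 1) (lookup-squaringChain-last t₀ (suc j)))
    (unique-solution⇒ThetaAtLeast system solution (candidate-solution 1≤t₀ u₀[2+t₀]≡t₀^2^k+1)
      solution-unique (suc (suc zero)))

theta-fermat-bound : (n : ℕ) → 5 < n → Prime (2 ^ 2 ^ (n ∸ 5) + 1) →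
  ThetaAtLeast n ((2 ^ 2 ^ (n ∸ 5) ∸ 1) ^ 2 ^ (n ∸ 5) + 1)
theta-fermat-bound _ (s≤s (s≤s (s≤s (s≤s (s≤s (s≤s _)))))) = FermatBound.theta-bound _

corollary2 :
    ((n : ℕ) → 5 < n → Prime (2 ^ (2 ^ (n ∸ 5)) + 1) →
      ThetaAtLeast n ((2 ^ (2 ^ (n ∸ 5)) ∸ 1) ^ (2 ^ (n ∸ 5)) + 1))
    × (ThetaAtLeast 9 ((2 ^ 16 ∸ 1) ^ 16 + 1)
       × ((2 ^ 240 < (2 ^ 16 ∸ 1) ^ 16 + 1) × (2 ^ (2 ^ 7) < 2 ^ 240)))
corollary2 =
  theta-fermat-bound ,
  theta-fermat-bound 9 (from-yes (5 <? 9)) (from-yes (prime? 65537)) ,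
  from-yes (2 ^ 240 <? (2 ^ 16 ∸ 1) ^ 16 + 1) ,
  from-yes (2 ^ 2 ^ 7 <? 2 ^ 240)
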